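{- Let $G$ be a complete graph on $|G|\geq 2$ vertices. Then $\mathcal{R}(G)=\frac{|G|}{2}$.
   Context: All graphs are finite, simple, connected and have at least two vertices; $d(x,y)$ is the shortest-path distance and $|G|$ the number of vertices. A vertex $w$ resolves two vertices $u,v$ if $d(u,w)\neq d(v,w)$. $V_p$ is the set of all unordered pairs $(u,v)$ of distinct vertices. For $(u,v)\in V_p$, $R(u,v)=\{x\in V(G): x \text{ resolves } u,v\}$, and for $w\in V(G)$ the resolving share is $r_w(u,v)=1/|R(u,v)|$ if $w$ resolves $u,v$, and $0$ otherwise. For $w\in V(G)$, $R(w)=\{(u,v)\in V_p: w \text{ resolves } u,v\}$, $ar_w(G)=\frac{1}{|R(w)|}\sum_{(u,v)\in R(w)} r_w(u,v)$, and the resolving topological index is $\mathcal{R}(G)=\sum_{w\in V(G)} ar_w(G)$. -}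

module Defs where

open import Data.Bool using (Bool; true; false; _∧_; _∨_; not)
open import Data.Bool.Properties using () renaming (_≟_ to _≟B_)
open import Data.Nat using (ℕ; zero; suc)
import Data.Nat as ℕ
open import Data.Fin using (Fin; toℕ) renaming (_≟_ to _≟F_)
open import Data.List using (List; []; _∷_; map; foldr; length; filter; concatMap; allFin; upTo)
open import Data.Bool.ListAction using (any)
open import Data.Product using (_×_; _,_)
open import Data.Integer using (+_)
open import Data.Rational using (ℚ; 0ℚ; _/_) renaming (_+_ to _+ℚ_; _*_ to _*ℚ_)
open import Relation.Nullary.Decidable using (⌊_⌋; ¬?)
open import Relation.Binary.PropositionalEquality using (_≡_; _≢_)

record Graph : Set where
  field
    n      : ℕ
    adj    : Fin n → Fin n → Bool
    sym    : ∀ u v → adj u v ≡ adj v u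
    irrefl : ∀ u → adj u u ≡ false

open Graph public

reach : (G : Graph) → ℕ → Fin (n G) → Fin (n G) → Bool
reach G zero    u v = ⌊ u ≟F v ⌋
reach G (suc k) u v = reach G k u v ∨ any (λ w → adj G u w ∧ reach G k w v) (allFin (n G))

Connected : Graph → Set
Connected G = ∀ u v → reach G (n G) u v ≡ true

Complete : Graph → Set
Complete G = ∀ u v → u ≢ v → adj G u v ≡ true

-- Shortest-path distance d(u,v): the least k with reach G k u v.  For a
-- connected graph this k is < n, and since reach is monotone in k it equals
-- the number of k < n for which reach G k u v is false.
dist : (G : Graph) → Fin (n G) → Fin (n G) → ℕ
dist G u v = length (filter (λ k → reach G k u v ≟B false) (upTo (n G)))

resolves : (G : Graph) → Fin (n G) → Fin (n G) → Fin (n G) → Bool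
resolves G w u v = not ⌊ dist G u w ℕ.≟ dist G v w ⌋

Vp : (G : Graph) → List (Fin (n G) × Fin (n G))
Vp G = concatMap (λ i → map (λ j → i , j) (filter (λ j → toℕ i ℕ.<? toℕ j) (allFin (n G))))
                 (allFin (n G))

cardRpair : (G : Graph) → Fin (n G) → Fin (n G) → ℕ
cardRpair G u v = length (filter (λ x → resolves G x u v ≟B true) (allFin (n G)))

Rw : (G : Graph) → Fin (n G) → List (Fin (n G) × Fin (n G))
Rw G w = filter (λ p → resolves G w (Data.Product.proj₁ p) (Data.Product.proj₂ p) ≟B true) (Vp G)
  where import Data.Product

-- 1/m as a rational, with the (never used for connected graphs) convention 1/0 = 0
inv : ℕ → ℚ
inv zero    = 0ℚ
inv (suc m) = + 1 / suc m

sumℚ : List ℚ → ℚ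
sumℚ = foldr _+ℚ_ 0ℚ

share : (G : Graph) → Fin (n G) → Fin (n G) → Fin (n G) → ℚ
share G w u v with resolves G w u v
... | true  = inv (cardRpair G u v)
... | false = 0ℚ

ar : (G : Graph) → Fin (n G) → ℚ
ar G w = inv (length (Rw G w)) *ℚ sumℚ (map (λ p → share G w (Data.Product.proj₁ p) (Data.Product.proj₂ p)) (Rw G w))
  where import Data.Product

resolvingIndex : Graph → ℚ
resolvingIndex G = sumℚ (map (ar G) (allFin (n G)))

module Submission where

-- In a complete graph d(u,u) = 0 and d(u,v) = 1 for u ≠ v, so a vertex w
-- resolves a pair u ≠ v exactly when w ∈ {u,v}.  Hence R(u,v) = {u,v},
-- every nonzero resolving share equals 1/2, and ar_w(G) is the mean of the
-- constant 1/2 over R(w).  Since n ≥ 2, R(w) is non-empty (w together with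
-- any other vertex forms a pair resolved by w), so ar_w(G) = 1/2, and
-- summing over the n vertices gives n/2.

open import Defs hiding (sym)
open import Data.Nat using (ℕ; zero; suc; _≤_; _<_; z≤n; s≤s)
import Data.Nat.Properties as ℕ
open import Data.Bool using (Bool; true; false; _∧_; _∨_)
open import Data.Bool.Properties using (∨-zeroʳ) renaming (_≟_ to _≟B_)
open import Data.Fin using (Fin; toℕ) renaming (zero to fzero; suc to fsuc; _≟_ to _≟F_)
open import Data.Fin.Properties using (toℕ<n)
open import Data.List using (List; []; _∷_; map; filter; length; allFin; upTo; applyUpTo)
open import Data.List.Properties using (filter-none; filter-accept; length-tabulate)
open import Data.List.Relation.Unary.All using (_∷_)
open import Data.List.Relation.Unary.All.Properties using (applyUpTo⁺₂)
open import Data.List.Relation.Unary.Any using (here; there; satisfied)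
open import Data.List.Relation.Unary.Unique.Propositional using (Unique)
import Data.List.Relation.Unary.AllPairs as AllPairs
open import Data.List.Relation.Unary.Unique.Propositional.Properties using (allFin⁺; filter⁺)
open import Data.List.Membership.Propositional using (_∈_; lose)
open import Data.List.Membership.Propositional.Properties
  using (∈-allFin; ∈-filter⁺; ∈-filter⁻; ∈-concatMap⁺; ∈-concatMap⁻; ∈-map⁺; ∈-map⁻)
open import Data.Bool.ListAction using (any)
open import Data.Product using (_×_; _,_; proj₁; proj₂; Σ-syntax)
open import Data.Sum using (_⊎_; inj₁; inj₂)
open import Data.Empty using (⊥-elim)
open import Data.Integer using (ℤ; +_) renaming (_+_ to _+ℤ_; _*_ to _*ℤ_)
open import Data.Integer.Tactic.RingSolver using (solve-∀)
open import Data.Rational using (ℚ; 1ℚ; ½; _/_; _+_; _*_; fromℚᵘ)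
open import Data.Rational.Properties
  using (fromℚᵘ-toℚᵘ; fromℚᵘ-cong; toℚᵘ-fromℚᵘ; toℚᵘ-homo-+; toℚᵘ-homo-*;
         *-assoc; *-identityˡ; *-zeroˡ; *-distribʳ-+)
open import Data.Rational.Unnormalised as ℚᵘ using (mkℚᵘ; *≡*; ↥_; ↧_)
import Data.Rational.Unnormalised.Properties as ℚᵘ
open import Relation.Nullary using (Dec; yes; no)
open import Relation.Nullary.Decidable using (isYes≗does; dec-true; dec-false)
open import Relation.Binary.PropositionalEquality
  using (_≡_; _≢_; refl; sym; trans; cong; cong₂; module ≡-Reasoning)


ℕ→ℚ : ℕ → ℚ
ℕ→ℚ k = + k / 1

-- Normalisation fromℚᵘ : ℚᵘ → ℚ preserves + and * …
fromℚᵘ-homo-+ : ∀ p q → fromℚᵘ p + fromℚᵘ q ≡ fromℚᵘ (p ℚᵘ.+ q)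
fromℚᵘ-homo-+ p q = trans (sym (fromℚᵘ-toℚᵘ _))
  (fromℚᵘ-cong (ℚᵘ.≃-trans (toℚᵘ-homo-+ (fromℚᵘ p) (fromℚᵘ q))
                           (ℚᵘ.+-cong (toℚᵘ-fromℚᵘ p) (toℚᵘ-fromℚᵘ q))))

fromℚᵘ-homo-* : ∀ p q → fromℚᵘ p * fromℚᵘ q ≡ fromℚᵘ (p ℚᵘ.* q)
fromℚᵘ-homo-* p q = trans (sym (fromℚᵘ-toℚᵘ _))
  (fromℚᵘ-cong (ℚᵘ.≃-trans (toℚᵘ-homo-* (fromℚᵘ p) (fromℚᵘ q))
                           (ℚᵘ.*-cong (toℚᵘ-fromℚᵘ p) (toℚᵘ-fromℚᵘ q))))

-- … and identifies fractions with equal cross-products.  Together these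
-- reduce identities between concrete fractions to ring identities in ℤ.
cross-multiply : ∀ p q → (↥ p) *ℤ (↧ q) ≡ (↥ q) *ℤ (↧ p) → fromℚᵘ p ≡ fromℚᵘ q
cross-multiply p q eq = fromℚᵘ-cong {p} {q} (*≡* eq)

ℕ→ℚ-suc : ∀ k → ℕ→ℚ (suc k) ≡ 1ℚ + ℕ→ℚ k
ℕ→ℚ-suc k = trans (cross-multiply (mkℚᵘ (+ suc k) 0) (mkℚᵘ (+ 1) 0 ℚᵘ.+ mkℚᵘ (+ k) 0)
                                  (identity (+ k)))
                  (sym (fromℚᵘ-homo-+ (mkℚᵘ (+ 1) 0) (mkℚᵘ (+ k) 0)))
  where
  identity : ∀ (x : ℤ) → (+ 1 +ℤ x) *ℤ + 1 ≡ (+ 1 *ℤ + 1 +ℤ x *ℤ + 1) *ℤ + 1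
  identity = solve-∀

inv-cancel : ∀ m → inv (suc m) * ℕ→ℚ (suc m) ≡ 1ℚ
inv-cancel m = trans (fromℚᵘ-homo-* (mkℚᵘ (+ 1) m) (mkℚᵘ (+ suc m) 0))
  (cross-multiply (mkℚᵘ (+ 1) m ℚᵘ.* mkℚᵘ (+ suc m) 0) (mkℚᵘ (+ 1) 0) (identity (+ m)))
  where
  identity : ∀ (x : ℤ) → (+ 1 *ℤ (+ 1 +ℤ x)) *ℤ + 1 ≡ + 1 *ℤ ((+ 1 +ℤ x) *ℤ + 1)
  identity = solve-∀

ℕ→ℚ-half : ∀ k → ℕ→ℚ k * ½ ≡ + k / 2
ℕ→ℚ-half k = trans (fromℚᵘ-homo-* (mkℚᵘ (+ k) 0) (mkℚᵘ (+ 1) 1))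
  (cross-multiply (mkℚᵘ (+ k) 0 ℚᵘ.* mkℚᵘ (+ 1) 1) (mkℚᵘ (+ k) 1) (identity (+ k)))
  where
  identity : ∀ (x : ℤ) → (x *ℤ + 1) *ℤ + 2 ≡ x *ℤ + 2
  identity = solve-∀

sum-const : {A : Set} (c : ℚ) (f : A → ℚ) (xs : List A) →
            (∀ x → x ∈ xs → f x ≡ c) → sumℚ (map f xs) ≡ ℕ→ℚ (length xs) * c
sum-const c f [] _ = sym (*-zeroˡ c)
sum-const c f (x ∷ xs) const = begin
  f x + sumℚ (map f xs)        ≡⟨ cong₂ _+_ (const x (here refl))
                                            (sum-const c f xs (λ y y∈ → const y (there y∈))) ⟩
  c + ℕ→ℚ k * c                ≡⟨ cong (_+ ℕ→ℚ k * c) (sym (*-identityˡ c)) ⟩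
  1ℚ * c + ℕ→ℚ k * c           ≡⟨ sym (*-distribʳ-+ c 1ℚ (ℕ→ℚ k)) ⟩
  (1ℚ + ℕ→ℚ k) * c             ≡⟨ cong (_* c) (sym (ℕ→ℚ-suc k)) ⟩
  ℕ→ℚ (suc k) * c              ∎
  where
  open ≡-Reasoning
  k : ℕ
  k = length xs

mean-const : {A : Set} (c : ℚ) (f : A → ℚ) (xs : List A) {y : A} → y ∈ xs →
             (∀ x → x ∈ xs → f x ≡ c) → inv (length xs) * sumℚ (map f xs) ≡ c
mean-const c f xs@(_ ∷ xs′) _ const = begin
  inv (suc m) * sumℚ (map f xs)          ≡⟨ cong (inv (suc m) *_) (sum-const c f xs const) ⟩
  inv (suc m) * (ℕ→ℚ (suc m) * c)        ≡⟨ sym (*-assoc (inv (suc m)) (ℕ→ℚ (suc m)) c) ⟩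
  (inv (suc m) * ℕ→ℚ (suc m)) * c        ≡⟨ cong (_* c) (inv-cancel m) ⟩
  1ℚ * c                                 ≡⟨ *-identityˡ c ⟩
  c                                      ∎
  where
  open ≡-Reasoning
  m : ℕ
  m = length xs′


-- The number of k < N at which b is false.  By definition,
-- dist G u v = falsesBelow (λ k → reach G k u v) (n G).
falsesBelow : (ℕ → Bool) → ℕ → ℕ
falsesBelow b N = length (filter (λ k → b k ≟B false) (upTo N))

true≢false : ∀ {b : Bool} → b ≡ true → b ≢ false
true≢false refl ()

falsesBelow-none : ∀ b N → (∀ k → b k ≡ true) → falsesBelow b N ≡ 0
falsesBelow-none b N always =
  cong length (filter-none (λ k → b k ≟B false) (applyUpTo⁺₂ (λ k → k) N (λ k → true≢false (always k))))

falsesBelow-first : ∀ b N → 0 < N → b 0 ≡ false → (∀ k → b (suc k) ≡ true) → falsesBelow b N ≡ 1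
falsesBelow-first b (suc N) _ b0 bsuc
  rewrite filter-accept (λ k → b k ≟B false) {xs = applyUpTo suc N} b0
        | filter-none (λ k → b k ≟B false) (applyUpTo⁺₂ suc N (λ k → true≢false (bsuc k)))
  = refl

pigeonhole : {A : Set} {u v x y z : A} → x ≢ y →
             x ≡ u ⊎ x ≡ v → y ≡ u ⊎ y ≡ v → z ≡ u ⊎ z ≡ v → z ≡ x ⊎ z ≡ y
pigeonhole x≢y (inj₁ refl) (inj₁ refl) _           = ⊥-elim (x≢y refl)
pigeonhole x≢y (inj₂ refl) (inj₂ refl) _           = ⊥-elim (x≢y refl)
pigeonhole _   (inj₁ refl) (inj₂ refl) (inj₁ refl) = inj₁ refl
pigeonhole _   (inj₁ refl) (inj₂ refl) (inj₂ refl) = inj₂ refl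
pigeonhole _   (inj₂ refl) (inj₁ refl) (inj₁ refl) = inj₂ refl
pigeonhole _   (inj₂ refl) (inj₁ refl) (inj₂ refl) = inj₁ refl

length-two : {A : Set} {u v : A} (ys : List A) → u ≢ v → Unique ys →
             (∀ {x} → x ∈ ys → x ≡ u ⊎ x ≡ v) → u ∈ ys → v ∈ ys → length ys ≡ 2
length-two [] _ _ _ () _
length-two (a ∷ []) u≢v _ _ (here refl) (here refl) = ⊥-elim (u≢v refl)
length-two (a ∷ b ∷ []) _ _ _ _ _ = refl
length-two (a ∷ b ∷ c ∷ _) _ ((a≢b ∷ a≢c ∷ _) AllPairs.∷ (b≢c ∷ _) AllPairs.∷ _) only _ _
  with pigeonhole a≢b (only (here refl)) (only (there (here refl))) (only (there (there (here refl))))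
... | inj₁ c≡a = ⊥-elim (a≢c (sym c≡a))
... | inj₂ c≡b = ⊥-elim (b≢c (sym c≡b))

length-allFin : ∀ N → length (allFin N) ≡ N
length-allFin N = length-tabulate (λ (i : Fin N) → i)


any-witness : {A : Set} (f : A → Bool) {xs : List A} {x : A} → x ∈ xs → f x ≡ true → any f xs ≡ true
any-witness f (here refl) fx rewrite fx = refl
any-witness f {y ∷ _} (there x∈) fx rewrite any-witness f x∈ fx = ∨-zeroʳ (f y)

module _ (G : Graph) where

  reach-refl : ∀ k v → reach G k v v ≡ true
  reach-refl zero    v = trans (isYes≗does (v ≟F v)) (dec-true (v ≟F v) refl)
  reach-refl (suc k) v rewrite reach-refl k v = refl

  reach-adj : ∀ k u v → adj G u v ≡ true → reach G (suc k) u v ≡ true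
  reach-adj k u v uv =
    trans (cong (reach G k u v ∨_) (any-witness _ (∈-allFin v) edge)) (∨-zeroʳ (reach G k u v))
    where
    edge : adj G u v ∧ reach G k v v ≡ true
    edge rewrite uv = reach-refl k v

  dist-self : ∀ v → dist G v v ≡ 0
  dist-self v = falsesBelow-none (λ k → reach G k v v) (n G) (λ k → reach-refl k v)

  -- Distinct adjacent vertices are at distance 1 (n > 0 since u is a vertex).
  dist-adjacent : ∀ u v → u ≢ v → adj G u v ≡ true → dist G u v ≡ 1
  dist-adjacent u v u≢v uv =
    falsesBelow-first (λ k → reach G k u v) (n G) (ℕ.≤-trans (s≤s z≤n) (toℕ<n u))
                      (trans (isYes≗does (u ≟F v)) (dec-false (u ≟F v) u≢v)) (λ k → reach-adj k u v uv)

  private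
    pairsFrom : Fin (n G) → List (Fin (n G) × Fin (n G))
    pairsFrom i = map (λ j → i , j) (filter (λ j → toℕ i ℕ.<? toℕ j) (allFin (n G)))

  Vp-ordered : ∀ {i j} → (i , j) ∈ Vp G → toℕ i < toℕ j
  Vp-ordered p∈ with satisfied (∈-concatMap⁻ pairsFrom {xs = allFin (n G)} p∈)
  ... | i , p∈pairsFrom with ∈-map⁻ (λ j → i , j) p∈pairsFrom
  ...   | _ , j∈ , refl = proj₂ (∈-filter⁻ (λ j → toℕ i ℕ.<? toℕ j) {xs = allFin (n G)} j∈)

  Vp-complete : ∀ {i j} → toℕ i < toℕ j → (i , j) ∈ Vp G
  Vp-complete {i} {j} i<j = ∈-concatMap⁺ pairsFrom (lose (∈-allFin i)
    (∈-map⁺ (λ j → i , j) (∈-filter⁺ (λ j → toℕ i ℕ.<? toℕ j) (∈-allFin j) i<j)))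

another-vertex : ∀ {N} → 2 ≤ N → (w : Fin N) → Σ[ x ∈ Fin N ] (toℕ w < toℕ x ⊎ toℕ x < toℕ w)
another-vertex {suc (suc N)} _ fzero    = fsuc fzero , inj₁ (s≤s z≤n)
another-vertex {suc (suc N)} _ (fsuc _) = fzero , inj₂ (s≤s z≤n)
another-vertex {suc zero} (s≤s ()) _

<⇒≢ : ∀ {N} {i j : Fin N} → toℕ i < toℕ j → i ≢ j
<⇒≢ i<j refl = ℕ.<-irrefl refl i<j

module _ (G : Graph) (complete : Complete G) where

  dist-distinct : ∀ u v → u ≢ v → dist G u v ≡ 1
  dist-distinct u v u≢v = dist-adjacent G u v u≢v (complete u v u≢v)

  endpoint-resolves : ∀ {w u v} → u ≢ v → w ≡ u ⊎ w ≡ v → resolves G w u v ≡ true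
  endpoint-resolves {u = u} {v} u≢v (inj₁ refl)
    rewrite dist-self G u | dist-distinct v u (λ v≡u → u≢v (sym v≡u)) = refl
  endpoint-resolves {u = u} {v} u≢v (inj₂ refl)
    rewrite dist-distinct u v u≢v | dist-self G v = refl

  nonendpoint-resolves-not : ∀ {w u v} → w ≢ u → w ≢ v → resolves G w u v ≡ false
  nonendpoint-resolves-not {w} {u} {v} w≢u w≢v
    rewrite dist-distinct u w (λ u≡w → w≢u (sym u≡w))
          | dist-distinct v w (λ v≡w → w≢v (sym v≡w)) = refl

  resolver-is-endpoint : ∀ {w u v} → resolves G w u v ≡ true → w ≡ u ⊎ w ≡ v
  resolver-is-endpoint {w} {u} {v} r with w ≟F u | w ≟F v
  ... | yes w≡u | _       = inj₁ w≡u
  ... | no _    | yes w≡v = inj₂ w≡v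
  ... | no w≢u  | no w≢v  = ⊥-elim (true≢false r (nonendpoint-resolves-not w≢u w≢v))

  cardR-distinct : ∀ {u v} → u ≢ v → cardRpair G u v ≡ 2
  cardR-distinct {u} {v} u≢v =
    length-two (filter resolves? (allFin (n G))) u≢v (filter⁺ resolves? (allFin⁺ (n G)))
               (λ x∈ → resolver-is-endpoint (proj₂ (∈-filter⁻ resolves? {xs = allFin (n G)} x∈)))
               (endpoint∈ (inj₁ refl)) (endpoint∈ (inj₂ refl))
    where
    resolves? : (x : Fin (n G)) → Dec (resolves G x u v ≡ true)
    resolves? x = resolves G x u v ≟B true
    endpoint∈ : ∀ {x} → x ≡ u ⊎ x ≡ v → x ∈ filter resolves? (allFin (n G))
    endpoint∈ {x} x∈uv = ∈-filter⁺ resolves? (∈-allFin x) (endpoint-resolves u≢v x∈uv)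

  share-half : ∀ w p → p ∈ Rw G w → share G w (proj₁ p) (proj₂ p) ≡ ½
  share-half w (u , v) p∈
    with ∈-filter⁻ (λ p → resolves G w (proj₁ p) (proj₂ p) ≟B true) {xs = Vp G} p∈
  ... | p∈Vp , r rewrite r | cardR-distinct (<⇒≢ (Vp-ordered G p∈Vp)) = refl

  ∈-Rw : ∀ {w u v} → toℕ u < toℕ v → resolves G w u v ≡ true → (u , v) ∈ Rw G w
  ∈-Rw {w} u<v r = ∈-filter⁺ (λ p → resolves G w (proj₁ p) (proj₂ p) ≟B true) (Vp-complete G u<v) r

  -- R(w) is non-empty: w resolves its pair with any other vertex.
  Rw-nonempty : 2 ≤ n G → ∀ w → Σ[ p ∈ Fin (n G) × Fin (n G) ] p ∈ Rw G w
  Rw-nonempty two w with another-vertex two w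
  ... | x , inj₁ w<x = (w , x) , ∈-Rw w<x (endpoint-resolves (<⇒≢ w<x) (inj₁ refl))
  ... | x , inj₂ x<w = (x , w) , ∈-Rw x<w (endpoint-resolves (<⇒≢ x<w) (inj₂ refl))

  ar-half : 2 ≤ n G → ∀ w → ar G w ≡ ½
  ar-half two w = mean-const ½ _ (Rw G w) (proj₂ (Rw-nonempty two w)) (share-half w)

-- R(G) is the sum of n copies of ar_w(G) = 1/2.
theorem3p9 : (G : Graph) → 2 ≤ n G → Connected G → Complete G →
    resolvingIndex G ≡ + (n G) / 2
theorem3p9 G two _ complete = begin
  resolvingIndex G                  ≡⟨ sum-const ½ (ar G) (allFin (n G)) (λ w _ → ar-half G complete two w) ⟩
  ℕ→ℚ (length (allFin (n G))) * ½   ≡⟨ cong (λ k → ℕ→ℚ k * ½) (length-allFin (n G)) ⟩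
  ℕ→ℚ (n G) * ½                     ≡⟨ ℕ→ℚ-half (n G) ⟩
  + (n G) / 2                       ∎
  where open ≡-Reasoning
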